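{- Let $m,n\geq 1$. Consider the alphabet $\overline{0}<1<\overline{1}<2<\overline{2}<3<\overline{3}<\cdots$ totally ordered as shown. A word $a_1a_2\cdots a_r$ in this alphabet is the area word of an element of $\mathrm{Polyo}_{m,n}$ if and only if: (1) $a_1=\overline{0}$ and this is the only occurrence of $\overline{0}$ in the word; (2) exactly $m$ of the letters $a_i$ are unbarred (from $\{1,2,3,\dots\}$) and exactly $n$ of them are barred (from $\{\overline{0},\overline{1},\overline{2},\dots\}$), so $r=m+n$; (3) for every $i=1,\dots,m+n-1$, the letter $a_{i+1}$ is less than or equal to the immediate successor of $a_i$ in the given order.
   Context: A parallelogram polyomino with an $m\times n$ bounding box is a pair of lattice paths (an upper path and a lower path) from $(0,0)$ to $(m,n)$ using unit North and East steps, which meet only at their starting and ending points, the upper path starting with a North step and the lower path with an East step. $\mathrm{Polyo}_{m,n}$ is the set of these; the interior is the region between the paths. Area word: for each East step of the lower path, draw from its East endpoint a line in the Northwest direction (slope $-1$) until it reaches the upper path, and label the step with the (unbarred) number of squares crossed. Then label each North step of the upper path with $\overline{k}$, where $k$ is the number of interior squares in the row immediately East of that step not crossed by any of the previously drawn lines. Read the labels in increasing order of $x+y$ of the starting point of the labelled step (a line of slope $-1$ sweeping from Southwest to Northeast), putting the upper-path label first in case of a tie. -}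

module Defs where

open import Data.Nat using (ℕ; zero; suc; _+_; _*_; _∸_; _≤_; _<ᵇ_; _≤ᵇ_; _≡ᵇ_)
open import Data.Bool using (Bool; true; false; _∧_; if_then_else_; not)
open import Data.Product using (_×_; _,_; ∃)
open import Data.Sum using (_⊎_)
open import Data.Maybe using (Maybe; just; nothing)
open import Data.List using (List; []; _∷_; _++_; length; upTo; concatMap; head)
open import Data.Bool.ListAction using (any)
open import Data.List.Membership.Propositional using (_∈_)
open import Data.List.Relation.Unary.Linked using (Linked)
open import Relation.Binary.PropositionalEquality using (_≡_)
open import Relation.Nullary using (¬_)

data Step : Set where
  N E : Step

countE : List Step → ℕ
countE []       = 0
countE (E ∷ ss) = suc (countE ss)
countE (N ∷ ss) = countE ss

countN : List Step → ℕ
countN []       = 0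
countN (N ∷ ss) = suc (countN ss)
countN (E ∷ ss) = countN ss

Point : Set
Point = ℕ × ℕ

move : Step → Point → Point
move N (x , y) = (x , suc y)
move E (x , y) = (suc x , y)

-- pos p k : the lattice point reached after the first k steps of p
-- (starting from (0,0)); meaningful for k ≤ length p.
pos : List Step → ℕ → Point
pos _        zero    = (0 , 0)
pos []       (suc k) = (0 , 0)
pos (s ∷ ss) (suc k) = move s (pos ss k)

stepAt : List Step → ℕ → Maybe Step
stepAt []       _       = nothing
stepAt (s ∷ ss) zero    = just s
stepAt (s ∷ ss) (suc k) = stepAt ss k

isN? isE? : Maybe Step → Bool
isN? (just N) = true
isN? _        = false
isE? (just E) = true
isE? _        = false

_==ᵖ_ : Point → Point → Bool
(a , b) ==ᵖ (c , d) = (a ≡ᵇ c) ∧ (b ≡ᵇ d)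

onPath : List Step → Point → Bool
onPath p q = any (λ k → pos p k ==ᵖ q) (upTo (suc (length p)))

record Polyo (m n : ℕ) : Set where
  field
    upper lower : List Step
    upper-E : countE upper ≡ m
    upper-N : countN upper ≡ n
    lower-E : countE lower ≡ m
    lower-N : countN lower ≡ n
    upper-start : head upper ≡ just N
    lower-start : head lower ≡ just E
    meet-only-ends : ∀ i j → i ≤ m + n → j ≤ m + n →
      pos upper i ≡ pos lower j →
      (pos upper i ≡ (0 , 0)) ⊎ (pos upper i ≡ (m , n))

data Letter : Set where
  bar   : ℕ → Letter
  unbar : ℕ → Letter   -- unbar k is  k  (must have k ≥ 1, see Valid)

data Valid : Letter → Set where
  bar-valid   : ∀ k → Valid (bar k)
  unbar-valid : ∀ k → Valid (unbar (suc k))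

rank : Letter → ℕ
rank (bar k)   = 2 * k
rank (unbar k) = 2 * k ∸ 1

_≤L_ : Letter → Letter → Set
a ≤L b = rank a ≤ rank b

succL : Letter → Letter
succL (bar k)   = unbar (suc k)
succL (unbar k) = bar k

-- find f s fuel : least t ∈ [s, s + fuel) with f t = true (s + fuel if none)
find : (ℕ → Bool) → ℕ → ℕ → ℕ
find f s zero       = s
find f s (suc fuel) = if f s then s else find f (suc s) fuel

module _ {m n : ℕ} (P : Polyo m n) where
  open Polyo P

  -- Label of the East step of the lower path starting at pos lower k = (x , y):
  -- the line of slope -1 from its East endpoint (x+1 , y) passes through the
  -- lattice points (x+1-t , y+t); the number of squares it crosses before
  -- reaching the upper path is the least t ≥ 1 with (x+1-t , y+t) on the upper path.
  eastLabel : ℕ → ℕ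
  eastLabel k with pos lower k
  ... | (x , y) = find (λ t → onPath upper (suc x ∸ t , y + t)) 1 (suc x)

  -- Is the unit square with lower-left corner (c , r) crossed by one of the lines
  -- drawn from the East steps of the lower path?  The line from the East step
  -- starting at (x , y) with label ℓ crosses the squares (x - t , y + t), t < ℓ.
  crossed : Point → Bool
  crossed (c , r) = any lineCrosses (upTo (m + n))
    where
    lineCrosses : ℕ → Bool
    lineCrosses k with pos lower k
    ... | (x , y) = isE? (stepAt lower k) ∧
          any (λ t → (t ≤ᵇ x) ∧ ((x ∸ t ≡ᵇ c) ∧ (y + t ≡ᵇ r))) (upTo (eastLabel k))

  -- Is the square with lower-left corner (c , r) in the interior, i.e. in row r
  -- between the North step of the upper path and the North step of the lower path?
  interior : Point → Bool
  interior (c , r) = leftOK ∧ rightOK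
    where
    leftOK  = any (λ k → isN? (stepAt upper k) ∧ upN k) (upTo (m + n))
      where
      upN : ℕ → Bool
      upN k with pos upper k
      ... | (a , b) = (a ≤ᵇ c) ∧ (b ≡ᵇ r)
    rightOK = any (λ k → isN? (stepAt lower k) ∧ loN k) (upTo (m + n))
      where
      loN : ℕ → Bool
      loN k with pos lower k
      ... | (a , b) = (c <ᵇ a) ∧ (b ≡ᵇ r)

  countTrue : (ℕ → Bool) → List ℕ → ℕ
  countTrue f []       = 0
  countTrue f (k ∷ ks) = if f k then suc (countTrue f ks) else countTrue f ks

  -- Label of the North step of the upper path starting at pos upper k = (x , y):
  -- the number of interior squares in row y East of that step not crossed by
  -- any of the lines.
  northLabel : ℕ → ℕ
  northLabel k with pos upper k
  ... | (x , y) = countTrue (λ c → (x ≤ᵇ c) ∧ (interior (c , y) ∧ not (crossed (c , y)))) (upTo m)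

  -- Steps are read in increasing order of x + y of their starting point; the
  -- k-th step of either path starts on the anti-diagonal x + y = k.  On ties the
  -- upper-path label comes first.
  areaWord : List Letter
  areaWord = concatMap letters (upTo (m + n))
    where
    letters : ℕ → List Letter
    letters k =
      (if isN? (stepAt upper k) then bar (northLabel k) ∷ [] else [])
      ++ (if isE? (stepAt lower k) then unbar (eastLabel k) ∷ [] else [])

countBarred countUnbarred : List Letter → ℕ
countBarred []              = 0
countBarred (bar _ ∷ w)     = suc (countBarred w)
countBarred (unbar _ ∷ w)   = countBarred w
countUnbarred []            = 0
countUnbarred (bar _ ∷ w)   = countUnbarred w
countUnbarred (unbar _ ∷ w) = suc (countUnbarred w)

Cond1 : List Letter → Set
Cond1 w = ∃ λ w′ → (w ≡ bar 0 ∷ w′) × ¬ (bar 0 ∈ w′)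

Cond2 : ℕ → ℕ → List Letter → Set
Cond2 m n w = (countUnbarred w ≡ m) × (countBarred w ≡ n)

Cond3 : List Letter → Set
Cond3 w = Linked (λ a b → b ≤L succL a) w

-- Walk along both boundary paths at once: after k steps each path sits on the anti-diagonal x + y = k,
-- the lower one gap k columns to the right of the upper one, and the gap changes according to the pair
-- of steps taken (nextGap).  Both kinds of labels are gaps.  The line of slope -1 from the end of an
-- East step of the lower path meets the upper path on the next anti-diagonal, so that step is labelled
-- gap (k + 1).  The uncrossed interior squares to the right of a North step of the upper path at height
-- y match the North steps the lower path still takes below height y, and there are gap k of them.
-- Hence the area word is the word of the walk of gaps (walkWord), which stays positive strictly between
-- the two corners.  Conversely a word satisfying (1)-(3) decodes greedily into such a walk, and every
-- such walk bounds a parallelogram polyomino.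

module Submission where

open import Defs
open import Data.Bool using (Bool; true; false; _∧_; not; if_then_else_; T)
open import Data.Bool.ListAction using (any)
open import Data.Bool.Properties using (T-∧; T-≡)
open import Data.List using (List; []; _∷_; length; upTo; applyUpTo; drop; concatMap; _++_; head)
open import Data.List.Membership.Propositional using (_∉_)
open import Data.List.Relation.Unary.All as All using (All; []; _∷_)
open import Data.List.Relation.Unary.Any using (here; there)
import Data.List.Relation.Unary.Any.Properties as Any
open import Data.List.Relation.Unary.Linked using (Linked; []; [-]; _∷_)
open import Data.Maybe using (Maybe; just; nothing)
open import Data.Nat
open import Data.Nat.Properties
open import Algebra.Properties.CommutativeSemigroup +-commutativeSemigroup using (x∙yz≈xz∙y; xy∙z≈xz∙y)
open import Data.Product
open import Data.Product.Properties using (×-≡,≡→≡)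
open import Data.Sum using (_⊎_; inj₁; inj₂)
open import Function using (_∘_; id)
open import Function.Bundles using (_⇔_; mk⇔; Equivalence)
open import Relation.Binary.PropositionalEquality
open import Relation.Nullary using (¬_; Dec; yes; no; contradiction)

private variable
  a b : Letter
  d : ℕ
  s t : Step
  u l : List Step
  v w : List Letter

2*-≤-odd⇒≤ : ∀ {i j} → 2 * i ≤ suc (2 * j) → i ≤ j
2*-≤-odd⇒≤ {i} {j} h with i ≤? j
... | yes i≤j = i≤j
... | no  i≰j = contradiction (≤-trans (*-monoʳ-≤ 2 (≰⇒> i≰j)) h)
                              (<⇒≱ (≤-reflexive (sym (*-suc 2 j))))

+-∸-antidiagonal : ∀ {x i} y → i ≤ x → (x ∸ i) + (y + i) ≡ x + y
+-∸-antidiagonal {x} {i} y i≤x = trans (x∙yz≈xz∙y (x ∸ i) y i) (cong (_+ y) (m∸n+n≡m i≤x))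

+-suc≡⇒< : ∀ {k K N} → k + suc K ≡ N → k < N
+-suc≡⇒< {k} eq = subst (k <_) eq (m<m+n k z<s)

+≡+⇒≤ : ∀ {a b c d} → a + b ≡ c + d → a ≤ c → d ≤ b
+≡+⇒≤ {a} {b} {c} {d} eq a≤c = +-cancelˡ-≤ c d b (subst (_≤ c + b) eq (+-monoˡ-≤ b a≤c))

+≡+⇒∸≡∸ : ∀ {a b c d} → a + b ≡ c + d → b ∸ d ≡ c ∸ a
+≡+⇒∸≡∸ {a} {b} {c} {d} eq = begin
  b ∸ d             ≡⟨ sym ([m+n]∸[m+o]≡n∸o a b d) ⟩
  (a + b) ∸ (a + d) ≡⟨ cong₂ _∸_ (trans eq (+-comm c d)) (+-comm a d) ⟩
  (d + c) ∸ (d + a) ≡⟨ [m+n]∸[m+o]≡n∸o d c a ⟩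
  c ∸ a             ∎
  where open ≡-Reasoning

data Positive : Letter → Set where
  bar   : ∀ k → Positive (bar (suc k))
  unbar : ∀ k → Positive (unbar (suc k))

Valid∧≢bar0⇒Positive : Valid a → bar 0 ≢ a → Positive a
Valid∧≢bar0⇒Positive (bar-valid zero)    ≢0 = contradiction refl ≢0
Valid∧≢bar0⇒Positive (bar-valid (suc k)) _  = bar k
Valid∧≢bar0⇒Positive (unbar-valid k)     _  = unbar k

allPositive : All Valid w → bar 0 ∉ w → All Positive w
allPositive []       _  = []
allPositive (a ∷ as) ∉w = Valid∧≢bar0⇒Positive a (∉w ∘ here) ∷ allPositive as (∉w ∘ there)

allPositive⇒bar0∉ : All Positive w → bar 0 ∉ w
allPositive⇒bar0∉ ps ∈w with All.lookup ps ∈w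
... | ()

_↝_ : Letter → Letter → Set
a ↝ b = b ≤L succL a

rank-unbar-suc : ∀ k → rank (unbar (suc k)) ≡ suc (2 * k)
rank-unbar-suc k = cong (_∸ 1) (*-suc 2 k)

↝-bar0⇒unbar1 : Positive b → bar 0 ↝ b → b ≡ unbar 1
↝-bar0⇒unbar1 (bar j) r = contradiction r (<⇒≱ (*-monoʳ-≤ 2 (s≤s (z≤n {j}))))
↝-bar0⇒unbar1 (unbar j) r
  with refl ← n≤0⇒n≡0 (2*-≤-odd⇒≤ {j} {0} (≤-trans (≤-pred (subst (_≤ 1) (rank-unbar-suc j) r)) z≤n))
  = refl

unbar↝bar⇒≤ : ∀ {j} → unbar (suc d) ↝ bar (suc j) → j ≤ d
unbar↝bar⇒≤ r = ≤-pred (*-cancelˡ-≤ 2 r)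

unbar↝unbar⇒≤ : ∀ {j} → unbar (suc d) ↝ unbar (suc j) → j ≤ d
unbar↝unbar⇒≤ {d} {j} r = 2*-≤-odd⇒≤ (≤-pred (subst₂ _≤_ (rank-unbar-suc j) (*-suc 2 d) r))

bar↝bar-tighten : ∀ {j} → bar (suc d) ↝ bar j → unbar (suc d) ↝ bar j
bar↝bar-tighten {d} {j} r =
  *-monoʳ-≤ 2 (2*-≤-odd⇒≤ {j} {suc d} (subst (rank (bar j) ≤_) (rank-unbar-suc (suc d)) r))

bar↝unbar-tighten : ∀ {j} → bar (suc d) ↝ unbar (suc j) → j ≢ suc d → unbar (suc d) ↝ unbar (suc j)
bar↝unbar-tighten {d} {j} r j≢ =
  subst₂ _≤_ (sym (rank-unbar-suc j)) (sym (*-suc 2 d)) (s≤s (≤-trans (*-monoʳ-≤ 2 j≤d) (n≤1+n _)))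
  where
  j≤d : j ≤ d
  j≤d = ≤-pred (≤∧≢⇒< (*-cancelˡ-≤ 2 (≤-pred (subst₂ _≤_ (rank-unbar-suc j) (rank-unbar-suc (suc d)) r)))
                       j≢)

-- Walks of the gap between two paths

nextGap : Step → Step → ℕ → ℕ
nextGap N N d = d
nextGap N E d = suc d
nextGap E E d = d
nextGap E N d = pred d

stepLetters : Step → Step → ℕ → List Letter
stepLetters N N d = bar d ∷ []
stepLetters N E d = bar d ∷ unbar (suc d) ∷ []
stepLetters E E d = unbar d ∷ []
stepLetters E N d = []

walkWord : ℕ → List Step → List Step → List Letter
walkWord d (s ∷ u) (t ∷ l) = stepLetters s t d ++ walkWord (nextGap s t d) u l
walkWord d []      _       = []
walkWord d (_ ∷ _) []      = []

-- The remaining steps of the upper and of the lower path, taken in pairs from gap d; the gap stays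
-- positive until both paths end together.
data Walk : ℕ → List Step → List Step → Set where
  done : Walk 0 [] []
  step : ∀ s t → Walk (nextGap s t (suc d)) u l → Walk (suc d) (s ∷ u) (t ∷ l)

walk-step : 0 < d → Walk (nextGap s t d) u l → Walk d (s ∷ u) (t ∷ l)
walk-step {suc d} _ w = step _ _ w

walk-counts : Walk d u l → countE u ≡ d + countE l × countN l ≡ d + countN u
walk-counts done = refl , refl
walk-counts {suc d} (step N N w) with eqE , eqN ← walk-counts w =
  eqE , trans (cong suc eqN) (sym (+-suc (suc d) _))
walk-counts {suc d} (step N E w) with eqE , eqN ← walk-counts w =
  trans eqE (sym (+-suc (suc d) _)) , trans eqN (sym (+-suc (suc d) _))
walk-counts {suc d} (step E E w) with eqE , eqN ← walk-counts w =
  trans (cong suc eqE) (sym (+-suc (suc d) _)) , eqN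
walk-counts {suc d} (step E N w) with eqE , eqN ← walk-counts w = cong suc eqE , cong suc eqN

countBarred-walkWord : Walk d u l → countBarred (walkWord d u l) ≡ countN u
countBarred-walkWord done = refl
countBarred-walkWord (step N N w) = cong suc (countBarred-walkWord w)
countBarred-walkWord (step N E w) = cong suc (countBarred-walkWord w)
countBarred-walkWord (step E E w) = countBarred-walkWord w
countBarred-walkWord (step E N w) = countBarred-walkWord w

countUnbarred-walkWord : Walk d u l → countUnbarred (walkWord d u l) ≡ countE l
countUnbarred-walkWord done = refl
countUnbarred-walkWord (step N N w) = countUnbarred-walkWord w
countUnbarred-walkWord (step N E w) = cong suc (countUnbarred-walkWord w)
countUnbarred-walkWord (step E E w) = cong suc (countUnbarred-walkWord w)
countUnbarred-walkWord (step E N w) = countUnbarred-walkWord w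

walkWord-positive : Walk d u l → All Positive (walkWord d u l)
walkWord-positive done = []
walkWord-positive {suc d} (step N N w) = bar d ∷ walkWord-positive w
walkWord-positive {suc d} (step N E w) = bar d ∷ unbar (suc d) ∷ walkWord-positive w
walkWord-positive {suc d} (step E E w) = unbar d ∷ walkWord-positive w
walkWord-positive {suc d} (step E N w) = walkWord-positive w

↝-weakenHead : rank (succL a) ≤ rank (succL b) → Linked _↝_ (a ∷ w) → Linked _↝_ (b ∷ w)
↝-weakenHead _  [-]      = [-]
↝-weakenHead le (r ∷ rs) = ≤-trans r le ∷ rs

-- The phantom first letter unbar d says that the word starts with a letter ≤ bar d.
walkWord-linked : Walk d u l → Linked _↝_ (unbar d ∷ walkWord d u l)
walkWord-linked done = [-]
walkWord-linked {suc d} (step N N w) =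
  ≤-refl ∷ ↝-weakenHead (≤-trans (n≤1+n _) (≤-reflexive (sym (rank-unbar-suc (suc d))))) (walkWord-linked w)
walkWord-linked (step N E w) = ≤-refl ∷ ≤-refl ∷ walkWord-linked w
walkWord-linked (step E E w) = m∸n≤m _ 1 ∷ walkWord-linked w
walkWord-linked {suc d} (step E N w) = ↝-weakenHead (*-monoʳ-≤ 2 (n≤1+n d)) (walkWord-linked w)

Decodes : ℕ → List Letter → Set
Decodes d v = ∃₂ λ u l → Walk (suc d) u l × walkWord (suc d) u l ≡ v

decodes-lower : ∀ {d′} → d ≤′ d′ → Decodes d v → Decodes d′ v
decodes-lower ≤′-refl        D = D
decodes-lower (≤′-step d≤d′) D with u , l , w , eq ← decodes-lower d≤d′ D =
  E ∷ u , N ∷ l , step E N w , eq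

decodes-NN : Decodes d v → Decodes d (bar (suc d) ∷ v)
decodes-NN (u , l , w , eq) = N ∷ u , N ∷ l , step N N w , cong (bar _ ∷_) eq

decodes-NE : Decodes (suc d) v → Decodes d (bar (suc d) ∷ unbar (suc (suc d)) ∷ v)
decodes-NE (u , l , w , eq) = N ∷ u , E ∷ l , step N E w , cong (λ v → bar _ ∷ unbar _ ∷ v) eq

decodes-EE : Decodes d v → Decodes d (unbar (suc d) ∷ v)
decodes-EE (u , l , w , eq) = E ∷ u , E ∷ l , step E E w , cong (unbar _ ∷_) eq

-- Decoding is greedy: bar (d + 1) followed by unbar (d + 2) comes from a pair (N, E), any other barred
-- letter from (N, N), an unbarred letter from (E, E), and pairs (E, N), which emit nothing, bring the
-- gap down to the one the next letter needs.
decode : ∀ d → All Positive v → Linked _↝_ (unbar (suc d) ∷ v) → Decodes d v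
decodeAfterBar : ∀ d → All Positive v → Linked _↝_ (bar (suc d) ∷ v) → Decodes d (bar (suc d) ∷ v)
decodeBarUnbar : ∀ d {j} → Dec (j ≡ suc d) → All Positive (unbar (suc j) ∷ v) →
  Linked _↝_ (bar (suc d) ∷ unbar (suc j) ∷ v) → Decodes d (bar (suc d) ∷ unbar (suc j) ∷ v)

decode d [] _ = decodes-lower (≤⇒≤′ z≤n) (E ∷ [] , N ∷ [] , step E N done , refl)
decode d (bar k ∷ ps) (r ∷ L) =
  decodes-lower (≤⇒≤′ (unbar↝bar⇒≤ r)) (decodeAfterBar k ps L)
decode d (unbar k ∷ ps) (r ∷ L) = decodes-lower (≤⇒≤′ (unbar↝unbar⇒≤ r)) (decodes-EE (decode k ps L))

decodeAfterBar d [] [-] = decodes-NN (decode d [] [-])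
decodeAfterBar d ps@(bar j ∷ _) (r ∷ L) = decodes-NN (decode d ps (bar↝bar-tighten {j = suc j} r ∷ L))
decodeAfterBar d ps@(unbar j ∷ _) L = decodeBarUnbar d (j ≟ suc d) ps L

decodeBarUnbar d (yes refl) (_ ∷ ps) (_ ∷ L) = decodes-NE (decode (suc d) ps L)
decodeBarUnbar d (no j≢)    ps       (r ∷ L) = decodes-NN (decode d ps (bar↝unbar-tighten r j≢ ∷ L))

walkWord-conditions : Walk 1 u l → let w = walkWord 0 (N ∷ u) (E ∷ l) in
  Cond1 w × Cond2 (countE (E ∷ l)) (countN (N ∷ u)) w × Cond3 w
walkWord-conditions w =
  (_ , refl , allPositive⇒bar0∉ (unbar 0 ∷ walkWord-positive w)) ,
  (cong suc (countUnbarred-walkWord w) , cong suc (countBarred-walkWord w)) ,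
  ≤-refl ∷ walkWord-linked w

decodeWord : All Valid w → Cond1 w → Cond3 w → 1 ≤ countUnbarred w →
  ∃₂ λ u l → Walk 1 u l × walkWord 0 (N ∷ u) (E ∷ l) ≡ w
decodeWord _ (_ , refl , _) [-] ()
decodeWord (_ ∷ vs) (_ , refl , ∉w′) (r ∷ L) _ with p ∷ ps ← allPositive vs ∉w′
  with refl ← ↝-bar0⇒unbar1 p r
  with u , l , w , eq ← decode 0 ps L = u , l , w , cong (λ v → bar 0 ∷ unbar 1 ∷ v) eq

T-∧⁺ : ∀ {b b′} → T b → T b′ → T (b ∧ b′)
T-∧⁺ tb tb′ = Equivalence.from T-∧ (tb , tb′)

T-∧⁻ : ∀ {b b′} → T (b ∧ b′) → T b × T b′
T-∧⁻ = Equivalence.to T-∧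

any-upTo⁺ : ∀ (f : ℕ → Bool) {K} i → i < K → T (f i) → T (any f (upTo K))
any-upTo⁺ f i i<K fi = Any.any⁺ f (Any.applyUpTo⁺ id fi i<K)

any-upTo⁻ : ∀ (f : ℕ → Bool) K → T (any f (upTo K)) → ∃ λ i → i < K × T (f i)
any-upTo⁻ f K h = Any.applyUpTo⁻ id (Any.any⁻ f _ h)

find-least : ∀ f s fuel j → j < fuel → T (f (s + j)) → (∀ i → i < j → ¬ T (f (s + i))) →
  find f s fuel ≡ s + j
find-least f s (suc fuel) zero _ fj _ rewrite +-identityʳ s with f s | fj
... | true  | _  = refl
... | false | ()
find-least f s (suc fuel) (suc j) (s≤s j<fuel) fj below
  with f s | below 0 z<s ∘ subst (T ∘ f) (sym (+-identityʳ s))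
... | true  | ¬fs = contradiction _ ¬fs
... | false | _   =
  trans (find-least f (suc s) fuel j j<fuel (subst (T ∘ f) (+-suc s j) fj)
           (λ i i<j → below (suc i) (s≤s i<j) ∘ subst (T ∘ f) (sym (+-suc s i))))
        (sym (+-suc s j))

¬T⇒T-not : ∀ {b} → ¬ T b → T (not b)
¬T⇒T-not {true}  ¬b = ¬b _
¬T⇒T-not {false} _  = _

T-not⇒¬T : ∀ {b} → T (not b) → ¬ T b
T-not⇒¬T {true} ()

T⇔T⇒≡ : ∀ {b b′} → (T b ⇔ T b′) → b ≡ b′
T⇔T⇒≡ {true}  {true}  _ = refl
T⇔T⇒≡ {true}  {false} h = contradiction (Equivalence.to h _) λ ()
T⇔T⇒≡ {false} {true}  h = contradiction (Equivalence.from h _) λ ()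
T⇔T⇒≡ {false} {false} _ = refl

countRange : (ℕ → Bool) → ℕ → ℕ → ℕ
countRange f k zero    = 0
countRange f k (suc K) = if f k then suc (countRange f (suc k) K) else countRange f (suc k) K

countRange-cong : ∀ f g k k′ K → (∀ j → j < K → f (k + j) ≡ g (k′ + j)) →
  countRange f k K ≡ countRange g k′ K
countRange-cong f g k k′ zero    eq = refl
countRange-cong f g k k′ (suc K) eq
  rewrite trans (cong f (sym (+-identityʳ k))) (trans (eq 0 z<s) (cong g (+-identityʳ k′)))
        | countRange-cong f g (suc k) (suc k′) K
            (λ j j<K → trans (cong f (sym (+-suc k j))) (trans (eq (suc j) (s≤s j<K)) (cong g (+-suc k′ j))))
  = refl

countRange-+ : ∀ f k K K′ → countRange f k (K + K′) ≡ countRange f k K + countRange f (k + K) K′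
countRange-+ f k zero    K′ = cong (λ i → countRange f i K′) (sym (+-identityʳ k))
countRange-+ f k (suc K) K′ rewrite +-suc k K with f k
... | true  = cong suc (countRange-+ f (suc k) K K′)
... | false = countRange-+ f (suc k) K K′

countRange-none : ∀ f k K → (∀ j → j < K → ¬ T (f (k + j))) → countRange f k K ≡ 0
countRange-none f k K none =
  trans (countRange-cong f (λ _ → false) k k K (λ j j<K → T⇔T⇒≡ (mk⇔ (none j j<K) λ ()))) (all-false K)
  where
  all-false : ∀ {i} K → countRange (λ _ → false) i K ≡ 0
  all-false zero    = refl
  all-false (suc K) = all-false K

X Y : List Step → ℕ → ℕ
X p k = proj₁ (pos p k)
Y p k = proj₂ (pos p k)

advance : Maybe Step → Point → Point
advance nothing  q = q
advance (just s) q = move s q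

move-comm : ∀ s t q → move s (move t q) ≡ move t (move s q)
move-comm N N q = refl
move-comm N E q = refl
move-comm E N q = refl
move-comm E E q = refl

pos-suc : ∀ p k → pos p (suc k) ≡ advance (stepAt p k) (pos p k)
pos-suc []      zero    = refl
pos-suc []      (suc k) = refl
pos-suc (s ∷ p) zero    = refl
pos-suc (s ∷ p) (suc k) with stepAt p k | pos-suc p k
... | nothing | eq = cong (move s) eq
... | just t  | eq = trans (cong (move s) eq) (move-comm s t (pos p k))

pos-suc-just : ∀ p k → stepAt p k ≡ just s → pos p (suc k) ≡ move s (pos p k)
pos-suc-just p k eq = trans (pos-suc p k) (cong (λ o → advance o (pos p k)) eq)

X-suc-bounds : ∀ p k → X p k ≤ X p (suc k) × X p (suc k) ≤ suc (X p k)
X-suc-bounds p k rewrite pos-suc p k with stepAt p k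
... | nothing = ≤-refl , n≤1+n _
... | just N  = ≤-refl , n≤1+n _
... | just E  = n≤1+n _ , ≤-refl

Y-suc : ∀ p k → Y p (suc k) ≡ (if isN? (stepAt p k) then suc (Y p k) else Y p k)
Y-suc p k rewrite pos-suc p k with stepAt p k
... | nothing = refl
... | just N  = refl
... | just E  = refl

Y-suc-bounds : ∀ p k → Y p k ≤ Y p (suc k) × Y p (suc k) ≤ suc (Y p k)
Y-suc-bounds p k rewrite Y-suc p k with isN? (stepAt p k)
... | true  = n≤1+n _ , ≤-refl
... | false = ≤-refl , n≤1+n _

monotone-by-step : ∀ (f : ℕ → ℕ) → (∀ k → f k ≤ f (suc k)) → ∀ {i j} → i ≤ j → f i ≤ f j
monotone-by-step f up = go ∘ ≤⇒≤′
  where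
  go : ∀ {i j} → i ≤′ j → f i ≤ f j
  go ≤′-refl        = ≤-refl
  go (≤′-step i≤′j) = ≤-trans (go i≤′j) (up _)

Y-mono : ∀ p {i j} → i ≤ j → Y p i ≤ Y p j
Y-mono p = monotone-by-step (Y p) (proj₁ ∘ Y-suc-bounds p)

X+Y≡ : ∀ p k → k ≤ length p → X p k + Y p k ≡ k
X+Y≡ p       zero    _         = refl
X+Y≡ (N ∷ p) (suc k) (s≤s k≤) = trans (+-suc (X p k) (Y p k)) (cong suc (X+Y≡ p k k≤))
X+Y≡ (E ∷ p) (suc k) (s≤s k≤) = cong suc (X+Y≡ p k k≤)

length≡countE+countN : ∀ p → length p ≡ countE p + countN p
length≡countE+countN []      = refl
length≡countE+countN (N ∷ p) = trans (cong suc (length≡countE+countN p)) (sym (+-suc _ _))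
length≡countE+countN (E ∷ p) = cong suc (length≡countE+countN p)

pos-end : ∀ p k → length p ≤ k → pos p k ≡ (countE p , countN p)
pos-end []      zero    _         = refl
pos-end []      (suc k) _         = refl
pos-end (N ∷ p) (suc k) (s≤s p≤) = cong (move N) (pos-end p k p≤)
pos-end (E ∷ p) (suc k) (s≤s p≤) = cong (move E) (pos-end p k p≤)

pos-bounded : ∀ p k → X p k ≤ countE p × Y p k ≤ countN p
pos-bounded []      zero    = z≤n , z≤n
pos-bounded []      (suc k) = z≤n , z≤n
pos-bounded (s ∷ p) zero    = z≤n , z≤n
pos-bounded (N ∷ p) (suc k) = map₂ s≤s (pos-bounded p k)
pos-bounded (E ∷ p) (suc k) = map₁ s≤s (pos-bounded p k)

stepAt-< : ∀ p k → stepAt p k ≡ just s → k < length p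
stepAt-< (_ ∷ p) zero    _  = z<s
stepAt-< (_ ∷ p) (suc k) eq = s≤s (stepAt-< p k eq)

stepAt-0 : ∀ (p : List Step) → stepAt p 0 ≡ head p
stepAt-0 []      = refl
stepAt-0 (_ ∷ _) = refl

isN?⇒ : ∀ {o} → T (isN? o) → o ≡ just N
isN?⇒ {just N} _ = refl

isE?⇒ : ∀ {o} → T (isE? o) → o ≡ just E
isE?⇒ {just E} _ = refl

stepAt-nothing⇒ : ∀ p k → stepAt p k ≡ nothing → length p ≤ k
stepAt-nothing⇒ []      k       _  = z≤n
stepAt-nothing⇒ (_ ∷ p) (suc k) eq = s≤s (stepAt-nothing⇒ p k eq)

stepAt-defined : ∀ p k → k < length p → ∃ λ s → stepAt p k ≡ just s
stepAt-defined (s ∷ p) zero    _          = s , refl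
stepAt-defined (_ ∷ p) (suc k) (s≤s k<p) = stepAt-defined p k k<p

drop-stepAt : ∀ p k → stepAt p k ≡ just s → drop k p ≡ s ∷ drop (suc k) p
drop-stepAt (_ ∷ p) zero    refl = refl
drop-stepAt (_ ∷ p) (suc k) eq   = drop-stepAt p k eq

drop-length : ∀ (p : List Step) k → length p ≤ k → drop k p ≡ []
drop-length []      zero    _         = refl
drop-length []      (suc k) _         = refl
drop-length (_ ∷ p) (suc k) (s≤s p≤) = drop-length p k p≤

Y-rises⇒N : ∀ p k → Y p k < Y p (suc k) → stepAt p k ≡ just N
Y-rises⇒N p k rises with stepAt p k | Y-suc p k
... | just N  | _   = refl
... | just E  | ysk = contradiction (subst (Y p k <_) ysk rises) (n≮n _)
... | nothing | ysk = contradiction (subst (Y p k <_) ysk rises) (n≮n _)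

N-step-at-height : ∀ p y {i j} → i ≤ j → Y p i ≤ y → y < Y p j →
  ∃ λ J → i ≤ J × J < j × Y p J ≡ y × stepAt p J ≡ just N
N-step-at-height p y i≤j = go (≤⇒≤′ i≤j)
  where
  go : ∀ {i j} → i ≤′ j → Y p i ≤ y → y < Y p j →
       ∃ λ J → i ≤ J × J < j × Y p J ≡ y × stepAt p J ≡ just N
  go ≤′-refl             yi≤y y<yj = contradiction y<yj (≤⇒≯ yi≤y)
  go (≤′-step {j} i≤′j) yi≤y y<yj with y <? Y p j
  ... | yes y<yj′ = map₂ (map₂ (map₁ (m≤n⇒m≤1+n))) (go i≤′j yi≤y y<yj′)
  ... | no  y≮yj′ =
    j , ≤′⇒≤ i≤′j , ≤-refl , yj≡y , Y-rises⇒N p j (≤-trans (s≤s (≮⇒≥ y≮yj′)) y<yj)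
    where
    yj≡y : Y p j ≡ y
    yj≡y = ≤-antisym (≮⇒≥ y≮yj′) (≤-pred (≤-trans y<yj (proj₂ (Y-suc-bounds p j))))

N-below : List Step → ℕ → ℕ → Bool
N-below p y j = isN? (stepAt p j) ∧ (Y p j <ᵇ y)

countRange-N-below : ∀ p y k K → Y p k ≤ y → y ≤ Y p (k + K) → countRange (N-below p y) k K ≡ y ∸ Y p k
countRange-N-below p y k zero    _    y≤Y =
  sym (m≤n⇒m∸n≡0 (subst (λ i → y ≤ Y p i) (+-identityʳ k) y≤Y))
countRange-N-below p y k (suc K) Y≤y  y≤Y with Y p k <? y
... | no  Y≮y = trans (countRange-none _ k (suc K) never) (sym (m≤n⇒m∸n≡0 (≮⇒≥ Y≮y)))
  where
  never : ∀ j → j < suc K → ¬ T (N-below p y (k + j))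
  never j _ h = ≤⇒≯ (≤-trans (≮⇒≥ Y≮y) (Y-mono p (m≤m+n k j))) (<ᵇ⇒< _ _ (proj₂ (T-∧⁻ h)))
... | yes Y<y rewrite Equivalence.to T-≡ (<⇒<ᵇ Y<y) | +-suc k K
    with isN? (stepAt p k) | Y-suc p k | countRange-N-below p y (suc k) K
...   | true  | Y-suc≡ | ih =
  trans (cong suc (ih (subst (_≤ y) (sym Y-suc≡) Y<y) y≤Y))
        (trans (cong (λ i → suc (y ∸ i)) Y-suc≡) (sym (+-∸-assoc 1 Y<y)))
...   | false | Y-suc≡ | ih = trans (ih (subst (_≤ y) (sym Y-suc≡) Y≤y) y≤Y) (cong (y ∸_) Y-suc≡)

T-==ᵖ : ∀ q q′ → T (q ==ᵖ q′) → q ≡ q′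
T-==ᵖ (a , b) (c , d) h with refl ← ≡ᵇ⇒≡ a c (proj₁ (T-∧⁻ h)) | refl ← ≡ᵇ⇒≡ b d (proj₂ (T-∧⁻ h)) = refl

==ᵖ-refl : ∀ q → T (q ==ᵖ q)
==ᵖ-refl (a , b) = T-∧⁺ (≡⇒≡ᵇ a a refl) (≡⇒≡ᵇ b b refl)

onPath⇒ : ∀ p a b → T (onPath p (a , b)) → pos p (a + b) ≡ (a , b)
onPath⇒ p a b h
  with i , s≤s i≤p , pi==ab ← any-upTo⁻ _ _ h
  with refl ← T-==ᵖ (pos p i) (a , b) pi==ab
  = cong (pos p) (X+Y≡ p i i≤p)

onPath⇐ : ∀ p i → i ≤ length p → T (onPath p (pos p i))
onPath⇐ p i i≤p = any-upTo⁺ _ i (s≤s i≤p) (==ᵖ-refl (pos p i))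



nextGap-move : ∀ s t {qᵘ qˡ : Point} → proj₁ qᵘ ≤ proj₁ qˡ →
  proj₁ (move t qˡ) ∸ proj₁ (move s qᵘ) ≡ nextGap s t (proj₁ qˡ ∸ proj₁ qᵘ)
nextGap-move N N _   = refl
nextGap-move N E x≤x = +-∸-assoc 1 x≤x
nextGap-move E E _   = refl
nextGap-move E N {qᵘ} {qˡ} _ = sym (pred[m∸n]≡m∸[1+n] (proj₁ qˡ) (proj₁ qᵘ))

-- The geometry of a parallelogram polyomino

module PolyoGeometry {m n : ℕ} (P : Polyo m n) where
  open Polyo P

  length-upper : length upper ≡ m + n
  length-upper = trans (length≡countE+countN upper) (cong₂ _+_ upper-E upper-N)

  length-lower : length lower ≡ m + n
  length-lower = trans (length≡countE+countN lower) (cong₂ _+_ lower-E lower-N)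

  upper-end : ∀ k → m + n ≤ k → pos upper k ≡ (m , n)
  upper-end k m+n≤k =
    trans (pos-end upper k (subst (_≤ k) (sym length-upper) m+n≤k)) (cong₂ _,_ upper-E upper-N)

  lower-end : ∀ k → m + n ≤ k → pos lower k ≡ (m , n)
  lower-end k m+n≤k =
    trans (pos-end lower k (subst (_≤ k) (sym length-lower) m+n≤k)) (cong₂ _,_ lower-E lower-N)

  X+Y≡-upper : ∀ k → k ≤ m + n → X upper k + Y upper k ≡ k
  X+Y≡-upper k k≤ = X+Y≡ upper k (subst (k ≤_) (sym length-upper) k≤)

  X+Y≡-lower : ∀ k → k ≤ m + n → X lower k + Y lower k ≡ k
  X+Y≡-lower k k≤ = X+Y≡ lower k (subst (k ≤_) (sym length-lower) k≤)

  stepAt-upper-< : ∀ k → stepAt upper k ≡ just s → k < m + n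
  stepAt-upper-< k eq = subst (k <_) length-upper (stepAt-< upper k eq)

  stepAt-lower-< : ∀ k → stepAt lower k ≡ just s → k < m + n
  stepAt-lower-< k eq = subst (k <_) length-lower (stepAt-< lower k eq)

  stepAt-upper-defined : ∀ k → k < m + n → ∃ λ s → stepAt upper k ≡ just s
  stepAt-upper-defined k k<m+n = stepAt-defined upper k (subst (k <_) (sym length-upper) k<m+n)

  stepAt-lower-defined : ∀ k → k < m + n → ∃ λ s → stepAt lower k ≡ just s
  stepAt-lower-defined k k<m+n = stepAt-defined lower k (subst (k <_) (sym length-lower) k<m+n)

  upper-first : stepAt upper 0 ≡ just N
  upper-first = trans (stepAt-0 upper) upper-start

  lower-first : stepAt lower 0 ≡ just E
  lower-first = trans (stepAt-0 lower) lower-start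

  X-upper-1 : X upper 1 ≡ 0
  X-upper-1 = cong proj₁ (pos-suc-just upper 0 upper-first)

  X-lower-1 : X lower 1 ≡ 1
  X-lower-1 = cong proj₁ (pos-suc-just lower 0 lower-first)

  upper-index : ∀ {k a b} → k ≤ m + n → pos upper k ≡ (a , b) → k ≡ a + b
  upper-index {k} k≤ eq = trans (sym (X+Y≡-upper k k≤)) (cong (λ q → proj₁ q + proj₂ q) eq)

  X≡⇒pos≡ : ∀ k → k ≤ m + n → X upper k ≡ X lower k → pos upper k ≡ pos lower k
  X≡⇒pos≡ k k≤ eqX = ×-≡,≡→≡ (eqX , +-cancelˡ-≡ (X upper k) _ _
    (trans (X+Y≡-upper k k≤) (sym (trans (cong (_+ Y lower k) eqX) (X+Y≡-lower k k≤)))))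

  pos-distinct : ∀ k → 0 < k → k < m + n → pos upper k ≢ pos lower k
  pos-distinct k 0<k k<m+n eq with meet-only-ends k k (<⇒≤ k<m+n) (<⇒≤ k<m+n) eq
  ... | inj₁ at-start = <⇒≢ 0<k (sym (upper-index (<⇒≤ k<m+n) at-start))
  ... | inj₂ at-end   = <⇒≢ k<m+n (upper-index (<⇒≤ k<m+n) at-end)

  X-upper<lower : ∀ k → 0 < k → k < m + n → X upper k < X lower k
  X-upper<lower (suc zero)    _ _     = subst₂ _<_ (sym X-upper-1) (sym X-lower-1) z<s
  X-upper<lower (suc (suc k)) _ k<m+n =
    ≤∧≢⇒< (X≤X (X-upper<lower (suc k) z<s (<-trans (n<1+n _) k<m+n)))
          (pos-distinct _ z<s k<m+n ∘ X≡⇒pos≡ _ (<⇒≤ k<m+n))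
    where
    X≤X : X upper (suc k) < X lower (suc k) → X upper (suc (suc k)) ≤ X lower (suc (suc k))
    X≤X X<X = ≤-trans (proj₂ (X-suc-bounds upper (suc k))) (≤-trans X<X (proj₁ (X-suc-bounds lower (suc k))))

  X-upper≤lower : ∀ k → X upper k ≤ X lower k
  X-upper≤lower zero    = z≤n
  X-upper≤lower (suc k) with suc k <? m + n
  ... | yes k<m+n = <⇒≤ (X-upper<lower (suc k) z<s k<m+n)
  ... | no  k≮m+n =
    ≤-reflexive (cong proj₁ (trans (upper-end _ (≮⇒≥ k≮m+n)) (sym (lower-end _ (≮⇒≥ k≮m+n)))))

  gap : ℕ → ℕ
  gap k = X lower k ∸ X upper k

  gap-positive : ∀ k → 0 < k → k < m + n → 0 < gap k
  gap-positive k 0<k k<m+n = m<n⇒0<n∸m (X-upper<lower k 0<k k<m+n)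

  gap-end : gap (m + n) ≡ 0
  gap-end =
    trans (cong₂ (λ q q′ → proj₁ q ∸ proj₁ q′) (lower-end _ ≤-refl) (upper-end _ ≤-refl)) (n∸n≡0 m)

  gap-suc : ∀ k → stepAt upper k ≡ just s → stepAt lower k ≡ just t → gap (suc k) ≡ nextGap s t (gap k)
  gap-suc {s} {t} k eqᵘ eqˡ =
    trans (cong₂ (λ q q′ → proj₁ q ∸ proj₁ q′) (pos-suc-just lower k eqˡ) (pos-suc-just upper k eqᵘ))
          (nextGap-move s t (X-upper≤lower k))

  X-upper-suc≤X-lower : ∀ k → stepAt lower k ≡ just E → X upper (suc k) ≤ X lower k
  X-upper-suc≤X-lower zero    _   = ≤-reflexive X-upper-1
  X-upper-suc≤X-lower (suc k) eqˡ =
    ≤-trans (proj₂ (X-suc-bounds upper (suc k))) (X-upper<lower (suc k) z<s (stepAt-lower-< (suc k) eqˡ))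

  eastLabel≡gap : ∀ k → stepAt lower k ≡ just E → eastLabel P k ≡ gap (suc k)
  eastLabel≡gap k eqˡ = begin
    find hits 1 (suc x) ≡⟨ find-least hits 1 (suc x) j (s≤s (m∸n≤m x xᵘ)) (hits-j) (misses) ⟩
    suc (x ∸ xᵘ)         ≡⟨ sym (+-∸-assoc 1 xᵘ≤x) ⟩
    suc x ∸ xᵘ           ≡⟨ cong (_∸ xᵘ) (sym X-lower-suc) ⟩
    gap (suc k)         ∎
    where
    open ≡-Reasoning
    x = X lower k
    y = Y lower k
    xᵘ = X upper (suc k)
    j = x ∸ xᵘ
    hits : ℕ → Bool
    hits t = onPath upper (suc x ∸ t , y + t)
    X-lower-suc : X lower (suc k) ≡ suc x
    X-lower-suc = cong proj₁ (pos-suc-just lower k eqˡ)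
    xᵘ≤x : xᵘ ≤ x
    xᵘ≤x = X-upper-suc≤X-lower k eqˡ
    k<m+n : k < m + n
    k<m+n = stepAt-lower-< k eqˡ
    x+y≡k : x + y ≡ k
    x+y≡k = X+Y≡-lower k (<⇒≤ k<m+n)
    on-antidiagonal : ∀ {i} → i ≤ x → (x ∸ i) + (y + suc i) ≡ suc k
    on-antidiagonal {i} i≤x = trans (cong ((x ∸ i) +_) (+-suc y i))
                                    (trans (+-suc (x ∸ i) (y + i)) (cong suc (trans (+-∸-antidiagonal y i≤x) x+y≡k)))
    hits-j : T (hits (1 + j))
    hits-j = subst (T ∘ onPath upper) (×-≡,≡→≡ (Xs , Ys))
                   (onPath⇐ upper (suc k) (subst (suc k ≤_) (sym length-upper) k<m+n))
      where
      Xs : xᵘ ≡ x ∸ j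
      Xs = sym (m∸[m∸n]≡n xᵘ≤x)
      Ys : Y upper (suc k) ≡ y + suc j
      Ys = +-cancelˡ-≡ xᵘ _ _ (trans (X+Y≡-upper (suc k) k<m+n)
             (trans (sym (on-antidiagonal (m∸n≤m x xᵘ))) (cong (_+ (y + suc j)) (sym Xs))))
    misses : ∀ i → i < j → ¬ T (hits (1 + i))
    misses i i<j h = <-irrefl (sym (trans (cong (x ∸_) xᵘ≡x∸i) (m∸[m∸n]≡n i≤x))) i<j
      where
      i≤x : i ≤ x
      i≤x = ≤-trans (<⇒≤ i<j) (m∸n≤m x xᵘ)
      xᵘ≡x∸i : xᵘ ≡ x ∸ i
      xᵘ≡x∸i = cong proj₁ (trans (cong (pos upper) (sym (on-antidiagonal i≤x)))
                                  (onPath⇒ upper (x ∸ i) (y + suc i) h))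

  countTrue-upTo : ∀ f K → countTrue P f (upTo K) ≡ countRange f 0 K
  countTrue-upTo f K = go id 0 K (λ _ → refl)
    where
    go : ∀ g k K → (∀ i → g i ≡ k + i) → countTrue P f (applyUpTo g K) ≡ countRange f k K
    go g k zero    _   = refl
    go g k (suc K) g≗ rewrite trans (g≗ 0) (+-identityʳ k) with f k
    ... | true  = cong suc (go (g ∘ suc) (suc k) K (λ i → trans (g≗ (suc i)) (+-suc k i)))
    ... | false = go (g ∘ suc) (suc k) K (λ i → trans (g≗ (suc i)) (+-suc k i))

  interior⇒ : ∀ c r → T (interior P (c , r)) → Y lower (suc (c + r)) ≤ r
  interior⇒ c r h
    with k , k<m+n , hk ←
           any-upTo⁻ (λ k → isN? (stepAt lower k) ∧ ((c <ᵇ X lower k) ∧ (Y lower k ≡ᵇ r))) (m + n) (proj₂ (T-∧⁻ h))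
    with c<X , Y≡r ← T-∧⁻ (proj₂ (T-∧⁻ {isN? (stepAt lower k)} hk)) =
    subst (Y lower (suc (c + r)) ≤_) (≡ᵇ⇒≡ (Y lower k) r Y≡r) (Y-mono lower c+r<k)
    where
    c+r<k : c + r < k
    c+r<k = subst (c + r <_) (X+Y≡-lower k (<⇒≤ k<m+n))
              (+-mono-<-≤ (<ᵇ⇒< c (X lower k) c<X) (≤-reflexive (sym (≡ᵇ⇒≡ (Y lower k) r Y≡r))))

  crossed⇒ : ∀ c r → T (crossed P (c , r)) → stepAt lower (c + r) ≡ just E
  crossed⇒ c r h
    with k , k<m+n , hk ← any-upTo⁻ _ _ h
    with isE , hline ← T-∧⁻ hk
    with t , _ , ht ← any-upTo⁻ _ (eastLabel P k) hline
    with t≤x , hxy ← T-∧⁻ ht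
    with X∸t≡c , Y+t≡r ← T-∧⁻ hxy =
    subst (λ i → stepAt lower i ≡ just E) c+r≡k (isE?⇒ isE)
    where
    c+r≡k : k ≡ c + r
    c+r≡k = trans (sym (X+Y≡-lower k (<⇒≤ k<m+n)))
              (trans (sym (+-∸-antidiagonal (Y lower k) (≤ᵇ⇒≤ t (X lower k) t≤x)))
                     (cong₂ _+_ (≡ᵇ⇒≡ (X lower k ∸ t) c X∸t≡c) (≡ᵇ⇒≡ (Y lower k + t) r Y+t≡r)))

  module NorthStep (k : ℕ) (eqᵘ : stepAt upper k ≡ just N) where
    x y : ℕ
    x = X upper k
    y = Y upper k

    k<m+n : k < m + n
    k<m+n = stepAt-upper-< k eqᵘ

    x+y≡k : x + y ≡ k
    x+y≡k = X+Y≡-upper k (<⇒≤ k<m+n)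

    Y-upper-suc : Y upper (suc k) ≡ suc y
    Y-upper-suc = cong proj₂ (pos-suc-just upper k eqᵘ)

    y<n : y < n
    y<n = subst₂ _≤_ Y-upper-suc upper-N (proj₂ (pos-bounded upper (suc k)))

    interior⇐ : ∀ c → x ≤ c → stepAt lower (c + y) ≡ just N → Y lower (c + y) < y →
                T (interior P (c , y))
    interior⇐ c x≤c eqˡ below = T-∧⁺ left right
      where
      left : T (any (λ i → isN? (stepAt upper i) ∧ ((X upper i ≤ᵇ c) ∧ (Y upper i ≡ᵇ y))) (upTo (m + n)))
      left = any-upTo⁺ _ k k<m+n
        (subst (λ o → T (isN? o ∧ ((x ≤ᵇ c) ∧ (y ≡ᵇ y)))) (sym eqᵘ) (T-∧⁺ (≤⇒≤ᵇ x≤c) (≡⇒≡ᵇ y y refl)))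
      Y-lower-suc : Y lower (suc (c + y)) ≡ suc (Y lower (c + y))
      Y-lower-suc = cong proj₂ (pos-suc-just lower (c + y) eqˡ)
      right : T (any (λ i → isN? (stepAt lower i) ∧ ((c <ᵇ X lower i) ∧ (Y lower i ≡ᵇ y))) (upTo (m + n)))
      right with J , c+y<J , J<m+n , YJ≡y , eqJ ←
                   N-step-at-height lower y (stepAt-lower-< (c + y) eqˡ) (subst (_≤ y) (sym Y-lower-suc) below)
                     (subst (y <_) (sym (cong proj₂ (lower-end (m + n) ≤-refl))) y<n) =
        any-upTo⁺ _ J J<m+n (subst (λ o → T (isN? o ∧ ((c <ᵇ X lower J) ∧ (Y lower J ≡ᵇ y)))) (sym eqJ)
                               (T-∧⁺ (<⇒<ᵇ c<XJ) (≡⇒≡ᵇ (Y lower J) y YJ≡y)))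
        where
        c<XJ : c < X lower J
        c<XJ = +-cancelʳ-≤ y (suc c) (X lower J)
                 (subst (suc (c + y) ≤_) (trans (sym (X+Y≡-lower J (<⇒≤ J<m+n))) (cong (X lower J +_) YJ≡y))
                        c+y<J)

    crossed⇐ : ∀ c → x ≤ c → stepAt lower (c + y) ≡ just E → Y lower (suc (c + y)) ≤ y →
               T (crossed P (c , y))
    crossed⇐ c x≤c eqˡ Y≤y = any-upTo⁺ _ j j<m+n
      (subst (λ o → T (isE? o ∧ any line (upTo (eastLabel P j)))) (sym eqˡ)
        (any-upTo⁺ line δ δ<label (T-∧⁺ (≤⇒≤ᵇ δ≤X) (T-∧⁺ (≡⇒≡ᵇ _ _ X∸δ≡c) (≡⇒≡ᵇ _ _ Y+δ≡y)))))
      where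
      j = c + y
      line : ℕ → Bool
      line i = (i ≤ᵇ X lower j) ∧ ((X lower j ∸ i ≡ᵇ c) ∧ (Y lower j + i ≡ᵇ y))
      j<m+n : j < m + n
      j<m+n = stepAt-lower-< j eqˡ
      Yj≤y : Y lower j ≤ y
      Yj≤y = subst (_≤ y) (cong proj₂ (pos-suc-just lower j eqˡ)) Y≤y
      δ = y ∸ Y lower j
      Y+δ≡y : Y lower j + δ ≡ y
      Y+δ≡y = m+[n∸m]≡n Yj≤y
      X≡c+δ : X lower j ≡ c + δ
      X≡c+δ = +-cancelʳ-≡ (Y lower j) (X lower j) (c + δ)
        (trans (X+Y≡-lower j (<⇒≤ j<m+n)) (trans (cong (c +_) (sym Y+δ≡y)) (x∙yz≈xz∙y c (Y lower j) δ)))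
      δ≤X : δ ≤ X lower j
      δ≤X = subst (δ ≤_) (sym X≡c+δ) (m≤n+m δ c)
      X∸δ≡c : X lower j ∸ δ ≡ c
      X∸δ≡c = trans (cong (_∸ δ) X≡c+δ) (m+n∸n≡m c δ)
      Xᵘ≤c : X upper (suc j) ≤ c
      Xᵘ≤c = +≡+⇒≤ (trans (cong suc (+-comm y c))
                     (sym (trans (+-comm (Y upper (suc j)) (X upper (suc j))) (X+Y≡-upper (suc j) j<m+n))))
                  (subst (_≤ Y upper (suc j)) Y-upper-suc
                     (Y-mono upper (s≤s (subst (_≤ j) x+y≡k (+-monoˡ-≤ y x≤c)))))
      δ<label : δ < eastLabel P j
      δ<label = subst (δ <_) (sym (eastLabel≡gap j eqˡ)) (begin-strict
        δ                               <⟨ n<1+n δ ⟩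
        suc δ                           ≡⟨ sym (m+n∸m≡n c (suc δ)) ⟩
        c + suc δ ∸ c                   ≡⟨ cong (_∸ c) (trans (+-suc c δ) (cong suc (sym X≡c+δ))) ⟩
        suc (X lower j) ∸ c             ≤⟨ ∸-monoʳ-≤ (suc (X lower j)) Xᵘ≤c ⟩
        suc (X lower j) ∸ X upper (suc j) ≡⟨ cong (λ q → proj₁ q ∸ X upper (suc j)) (sym (pos-suc-just lower j eqˡ)) ⟩
        gap (suc j)                     ∎)
        where open ≤-Reasoning

    uncovered : ℕ → Bool
    uncovered c = (x ≤ᵇ c) ∧ (interior P (c , y) ∧ not (crossed P (c , y)))

    uncovered⇔N-below : ∀ c → x ≤ c → T (uncovered c) ⇔ T (N-below lower y (c + y))
    uncovered⇔N-below c x≤c = mk⇔ to from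
      where
      to : T (uncovered c) → T (N-below lower y (c + y))
      to h with inside , ¬crossed ← T-∧⁻ {interior P (c , y)} (proj₂ (T-∧⁻ {x ≤ᵇ c} h))
                | stepAt lower (c + y) in eqˡ
      ... | just N  = <⇒<ᵇ (subst (_≤ y) (cong proj₂ (pos-suc-just lower (c + y) eqˡ)) (interior⇒ c y inside))
      ... | just E  = contradiction (crossed⇐ c x≤c eqˡ (interior⇒ c y inside)) (T-not⇒¬T ¬crossed)
      ... | nothing = contradiction (interior⇒ c y inside) (<⇒≱ (subst (y <_) (sym Y≡n) y<n))
        where
        Y≡n : Y lower (suc (c + y)) ≡ n
        Y≡n = cong proj₂ (lower-end _ (subst (_≤ suc (c + y)) length-lower
                                         (m≤n⇒m≤1+n (stepAt-nothing⇒ lower _ eqˡ))))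
      from : T (N-below lower y (c + y)) → T (uncovered c)
      from g with isN , below ← T-∧⁻ {isN? (stepAt lower (c + y))} g =
        T-∧⁺ (≤⇒≤ᵇ x≤c) (T-∧⁺ (interior⇐ c x≤c eqˡ (<ᵇ⇒< _ y below))
                              (¬T⇒T-not (λ cr → N≢E (trans (sym eqˡ) (crossed⇒ c y cr)))))
        where
        eqˡ : stepAt lower (c + y) ≡ just N
        eqˡ = isN?⇒ isN
        N≢E : just N ≢ just E
        N≢E ()

    northLabel≡gap : northLabel P k ≡ gap k
    northLabel≡gap = begin
      northLabel P k
        ≡⟨ countTrue-upTo uncovered m ⟩
      countRange uncovered 0 m
        ≡⟨ cong (countRange uncovered 0) (sym (m+[n∸m]≡n x≤m)) ⟩
      countRange uncovered 0 (x + (m ∸ x))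
        ≡⟨ countRange-+ uncovered 0 x (m ∸ x) ⟩
      countRange uncovered 0 x + countRange uncovered x (m ∸ x)
        ≡⟨ cong₂ _+_ left-of-x right-of-x ⟩
      countRange (N-below lower y) k (m ∸ x)
        ≡⟨ countRange-N-below lower y k (m ∸ x) Yˡ≤y y≤Yˡ ⟩
      y ∸ Y lower k
        ≡⟨ +≡+⇒∸≡∸ {x} {y} {X lower k} {Y lower k} x+y≡X+Y ⟩
      gap k ∎
      where
      open ≡-Reasoning
      x+y≡X+Y : x + y ≡ X lower k + Y lower k
      x+y≡X+Y = trans x+y≡k (sym (X+Y≡-lower k (<⇒≤ k<m+n)))
      x≤m : x ≤ m
      x≤m = subst (x ≤_) upper-E (proj₁ (pos-bounded upper k))
      left-of-x : countRange uncovered 0 x ≡ 0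
      left-of-x = countRange-none uncovered 0 x λ i i<x h → <⇒≱ i<x (≤ᵇ⇒≤ x i (proj₁ (T-∧⁻ {x ≤ᵇ i} h)))
      right-of-x : countRange uncovered x (m ∸ x) ≡ countRange (N-below lower y) k (m ∸ x)
      right-of-x = countRange-cong uncovered (N-below lower y) x k (m ∸ x) λ i _ →
        trans (T⇔T⇒≡ (uncovered⇔N-below (x + i) (m≤m+n x i)))
              (cong (N-below lower y) (trans (xy∙z≈xz∙y x i y) (cong (_+ i) x+y≡k)))
      Yˡ≤y : Y lower k ≤ y
      Yˡ≤y = +≡+⇒≤ x+y≡X+Y (X-upper≤lower k)
      y≤Yˡ : y ≤ Y lower (k + (m ∸ x))
      y≤Yˡ = subst (λ i → y ≤ Y lower i) (sym k+[m∸x]≡m+y)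
               (+≡+⇒≤ (X+Y≡-lower (m + y) (+-monoʳ-≤ m (<⇒≤ y<n)))
                      (subst (X lower (m + y) ≤_) lower-E (proj₁ (pos-bounded lower (m + y)))))
        where
        k+[m∸x]≡m+y : k + (m ∸ x) ≡ m + y
        k+[m∸x]≡m+y = trans (cong (_+ (m ∸ x)) (sym x+y≡k))
                        (trans (xy∙z≈xz∙y x y (m ∸ x)) (cong (_+ y) (m+[n∸m]≡n x≤m)))

  areaLetters : ℕ → List Letter
  areaLetters k = (if isN? (stepAt upper k) then bar (northLabel P k) ∷ [] else [])
                  ++ (if isE? (stepAt lower k) then unbar (eastLabel P k) ∷ [] else [])

  areaLetters≡stepLetters : ∀ k → stepAt upper k ≡ just s → stepAt lower k ≡ just t →
    areaLetters k ≡ stepLetters s t (gap k)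
  areaLetters≡stepLetters {N} {N} k eqᵘ eqˡ rewrite eqᵘ | eqˡ | NorthStep.northLabel≡gap k eqᵘ = refl
  areaLetters≡stepLetters {N} {E} k eqᵘ eqˡ
    rewrite eqᵘ | eqˡ | NorthStep.northLabel≡gap k eqᵘ | eastLabel≡gap k eqˡ | gap-suc k eqᵘ eqˡ = refl
  areaLetters≡stepLetters {E} {E} k eqᵘ eqˡ rewrite eqᵘ | eqˡ | eastLabel≡gap k eqˡ | gap-suc k eqᵘ eqˡ = refl
  areaLetters≡stepLetters {E} {N} k eqᵘ eqˡ rewrite eqᵘ | eqˡ = refl

  areaLetters-from : ∀ g k K → (∀ i → g i ≡ k + i) → k + K ≡ m + n →
    concatMap areaLetters (applyUpTo g K) ≡ walkWord (gap k) (drop k upper) (drop k lower)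
  areaLetters-from g k zero _ k+0≡m+n
    rewrite drop-length upper k (≤-reflexive (trans length-upper (trans (sym k+0≡m+n) (+-identityʳ k))))
    = refl
  areaLetters-from g k (suc K) g≗ k+K≡m+n
    with s , eqᵘ ← stepAt-upper-defined k (+-suc≡⇒< k+K≡m+n)
       | t , eqˡ ← stepAt-lower-defined k (+-suc≡⇒< k+K≡m+n)
    rewrite drop-stepAt upper k eqᵘ | drop-stepAt lower k eqˡ = begin
      areaLetters (g 0) ++ concatMap areaLetters (applyUpTo (g ∘ suc) K)
        ≡⟨ cong₂ _++_ (cong areaLetters (trans (g≗ 0) (+-identityʳ k)))
                      (areaLetters-from (g ∘ suc) (suc k) K (λ i → trans (g≗ (suc i)) (+-suc k i))
                         (trans (sym (+-suc k K)) k+K≡m+n)) ⟩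
      areaLetters k ++ walkWord (gap (suc k)) (drop (suc k) upper) (drop (suc k) lower)
        ≡⟨ cong₂ (λ w g → w ++ walkWord g (drop (suc k) upper) (drop (suc k) lower))
                 (areaLetters≡stepLetters k eqᵘ eqˡ) (gap-suc k eqᵘ eqˡ) ⟩
      stepLetters s t (gap k) ++ walkWord (nextGap s t (gap k)) (drop (suc k) upper) (drop (suc k) lower) ∎
    where open ≡-Reasoning

  areaWord≡walkWord : areaWord P ≡ walkWord 0 upper lower
  areaWord≡walkWord = areaLetters-from id 0 (m + n) (λ _ → refl) refl

  walk-from : ∀ K k → 0 < k → k + K ≡ m + n → Walk (gap k) (drop k upper) (drop k lower)
  walk-from zero k _ k+0≡m+n with refl ← trans (sym (+-identityʳ k)) k+0≡m+n
    rewrite gap-end | drop-length upper (m + n) (≤-reflexive length-upper)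
          | drop-length lower (m + n) (≤-reflexive length-lower) = done
  walk-from (suc K) k 0<k k+K≡m+n
    with s , eqᵘ ← stepAt-upper-defined k (+-suc≡⇒< k+K≡m+n)
       | t , eqˡ ← stepAt-lower-defined k (+-suc≡⇒< k+K≡m+n)
    rewrite drop-stepAt upper k eqᵘ | drop-stepAt lower k eqˡ =
    walk-step (gap-positive k 0<k (stepAt-upper-< k eqᵘ))
      (subst (λ g → Walk g _ _) (gap-suc k eqᵘ eqˡ) (walk-from K (suc k) z<s (trans (sym (+-suc k K)) k+K≡m+n)))

  walk-after-first-step : Walk 1 (drop 1 upper) (drop 1 lower)
  walk-after-first-step = subst (λ g → Walk g (drop 1 upper) (drop 1 lower)) (cong₂ _∸_ X-lower-1 X-upper-1)
    (walk-from (m + n ∸ 1) 1 z<s (m+[n∸m]≡n (stepAt-upper-< 0 upper-first)))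

  areaWord-conditions : Cond1 (areaWord P) × Cond2 m n (areaWord P) × Cond3 (areaWord P)
  areaWord-conditions with c1 , c2 , c3 ← walkWord-conditions walk-after-first-step =
    subst (λ w → Cond1 w × Cond2 m n w × Cond3 w) (sym areaWord≡)
      (c1 , subst₂ (λ m′ n′ → Cond2 m′ n′ word) countE-lower countN-upper c2 , c3)
    where
    upper-split : upper ≡ N ∷ drop 1 upper
    upper-split = drop-stepAt upper 0 upper-first
    lower-split : lower ≡ E ∷ drop 1 lower
    lower-split = drop-stepAt lower 0 lower-first
    word : List Letter
    word = walkWord 0 (N ∷ drop 1 upper) (E ∷ drop 1 lower)
    areaWord≡ : areaWord P ≡ word
    areaWord≡ = trans areaWord≡walkWord (cong₂ (walkWord 0) upper-split lower-split)
    countE-lower : countE (E ∷ drop 1 lower) ≡ m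
    countE-lower = trans (cong countE (sym lower-split)) lower-E
    countN-upper : countN (N ∷ drop 1 upper) ≡ n
    countN-upper = trans (cong countN (sym upper-split)) upper-N

-- Polyominoes from walks

walk-X< : Walk d u l → ∀ i → i < length u → X u i < X l i + d
walk-X< (step _ _ _) zero    _          = s≤s z≤n
walk-X< (step N N w) (suc i) (s≤s i<u) = walk-X< w i i<u
walk-X< (step N E w) (suc i) (s≤s i<u) = ≤-trans (walk-X< w i i<u) (≤-reflexive (+-suc _ _))
walk-X< (step E E w) (suc i) (s≤s i<u) = s≤s (walk-X< w i i<u)
walk-X< (step E N w) (suc i) (s≤s i<u) = ≤-trans (s≤s (walk-X< w i i<u)) (≤-reflexive (sym (+-suc _ _)))

walk-polyo : ∀ {m n} → Walk 1 u l → countE (E ∷ l) ≡ m → countN (N ∷ u) ≡ n → Polyo m n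
walk-polyo {u} {l} {m} {n} w lower-E upper-N = record
  { upper          = N ∷ u
  ; lower          = E ∷ l
  ; upper-E        = upper-E
  ; upper-N        = upper-N
  ; lower-E        = lower-E
  ; lower-N        = lower-N
  ; upper-start    = refl
  ; lower-start    = refl
  ; meet-only-ends = meet-only-ends
  }
  where
  upper-E : countE (N ∷ u) ≡ m
  upper-E = trans (proj₁ (walk-counts w)) lower-E
  lower-N : countN (E ∷ l) ≡ n
  lower-N = trans (proj₂ (walk-counts w)) upper-N
  length-upper : length (N ∷ u) ≡ m + n
  length-upper = trans (length≡countE+countN (N ∷ u)) (cong₂ _+_ upper-E upper-N)
  length-lower : length (E ∷ l) ≡ m + n
  length-lower = trans (length≡countE+countN (E ∷ l)) (cong₂ _+_ lower-E lower-N)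
  same-index : ∀ {i j} → i ≤ m + n → j ≤ m + n → pos (N ∷ u) i ≡ pos (E ∷ l) j → i ≡ j
  same-index {i} {j} i≤ j≤ eq =
    trans (sym (X+Y≡ (N ∷ u) i (subst (i ≤_) (sym length-upper) i≤)))
          (trans (cong (λ q → proj₁ q + proj₂ q) eq) (X+Y≡ (E ∷ l) j (subst (j ≤_) (sym length-lower) j≤)))
  meet-on-diagonal : ∀ i → pos (N ∷ u) i ≡ pos (E ∷ l) i → (pos (N ∷ u) i ≡ (0 , 0)) ⊎ (pos (N ∷ u) i ≡ (m , n))
  meet-on-diagonal zero    _  = inj₁ refl
  meet-on-diagonal (suc i) eq with suc i <? m + n
  ... | yes i<m+n = contradiction (trans (cong proj₁ eq) (+-comm 1 (X l i)))
                      (<⇒≢ (walk-X< w i (≤-pred (subst (suc i <_) (sym length-upper) i<m+n))))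
  ... | no  i≮m+n = inj₂ (trans (pos-end (N ∷ u) (suc i) (subst (_≤ suc i) (sym length-upper) (≮⇒≥ i≮m+n)))
                                (cong₂ _,_ upper-E upper-N))
  meet-only-ends : ∀ i j → i ≤ m + n → j ≤ m + n → pos (N ∷ u) i ≡ pos (E ∷ l) j →
    (pos (N ∷ u) i ≡ (0 , 0)) ⊎ (pos (N ∷ u) i ≡ (m , n))
  meet-only-ends i j i≤ j≤ eq with refl ← same-index i≤ j≤ eq = meet-on-diagonal i eq

corollary3p2 : (m n : ℕ) → 1 ≤ m → 1 ≤ n → (w : List Letter) → All Valid w →
    (∃ λ (P : Polyo m n) → areaWord P ≡ w) ⇔ (Cond1 w × Cond2 m n w × Cond3 w)
corollary3p2 m n 1≤m _ w valid = mk⇔ polyo⇒conditions conditions⇒polyo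
  where
  polyo⇒conditions : (∃ λ (P : Polyo m n) → areaWord P ≡ w) → Cond1 w × Cond2 m n w × Cond3 w
  polyo⇒conditions (P , refl) = PolyoGeometry.areaWord-conditions P
  conditions⇒polyo : Cond1 w × Cond2 m n w × Cond3 w → ∃ λ (P : Polyo m n) → areaWord P ≡ w
  conditions⇒polyo (c1 , (unbarred≡m , barred≡n) , c3)
    with u , l , walk , eq ← decodeWord valid c1 c3 (subst (1 ≤_) (sym unbarred≡m) 1≤m)
    with _ , (unbarred≡ , barred≡) , _ ← walkWord-conditions walk
    = P , trans (PolyoGeometry.areaWord≡walkWord P) eq
    where
    P : Polyo m n
    P = walk-polyo walk (trans (sym unbarred≡) (trans (cong countUnbarred eq) unbarred≡m))
                        (trans (sym barred≡) (trans (cong countBarred eq) barred≡n))
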